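{- Let $d$ be a non-negative integer and let $\mathcal C$ be a $d$-contractible class of graphs. Then every graph in $\mathcal C$ has oriented twin-width at most $d$.
   Context: For a graph $G$ and two (not necessarily adjacent) vertices $x,y$, $G/\{x,y\}$ is the simple graph obtained by replacing $x,y$ by a single new vertex $\{x,y\}$ adjacent to all neighbors of $x$ or $y$ in $G$ other than $x,y$. A class $\mathcal C$ of graphs is $d$-contractible if for every graph $G\in\mathcal C$ with at least two vertices there exist two vertices $x,y$ of $G$ such that $G/\{x,y\}\in\mathcal C$ and the vertex $\{x,y\}$ has degree at most $d$ in $G/\{x,y\}$. A partition sequence of an $n$-vertex graph $G$ is a sequence $\mathcal P_n,\dots,\mathcal P_1$ of partitions of $V(G)$ where $\mathcal P_n$ consists of singletons, $\mathcal P_1=\{V(G)\}$, and each $\mathcal P_i$ is obtained from $\mathcal P_{i+1}$ by merging two parts. For a partition $\mathcal P$, the directed red graph has vertex set $\mathcal P$ and an arc $X\to Y$ between distinct parts whenever some vertex of $Y$ has both a neighbor and a non-neighbor in $X$. The oriented twin-width of $G$ is the minimum over partition sequences of $\max_i$ of the maximum out-degree of the directed red graph of $\mathcal P_i$. -}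

module Defs where

open import Data.Nat using (ℕ; zero; suc; _+_; _≤_)
open import Data.Bool using (Bool; true; false; not; _∧_; _∨_; if_then_else_)
open import Data.Bool.Properties using (∨-comm)
open import Data.Fin using (Fin; zero; suc; punchIn; punchOut; _≟_)
open import Data.Product using (Σ; ∃; _×_; _,_)
open import Data.Unit using (⊤)
open import Function using (_∘_)
open import Relation.Nullary using (¬_; yes; no)
open import Relation.Nullary.Decidable using (⌊_⌋)
open import Relation.Binary.PropositionalEquality using (_≡_; _≢_; refl; sym; cong; cong₂)

record Graph (n : ℕ) : Set where
  field
    adj    : Fin n → Fin n → Bool
    adjSym : ∀ u v → adj u v ≡ adj v u
    irrefl : ∀ u → adj u u ≡ false
open Graph public

Class : Set₁
Class = (n : ℕ) → Graph n → Set

countB : ∀ {n} → (Fin n → Bool) → ℕ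
countB {zero}  f = 0
countB {suc n} f = (if f zero then 1 else 0) + countB (f ∘ suc)

anyB : ∀ {n} → (Fin n → Bool) → Bool
anyB {zero}  f = false
anyB {suc n} f = f zero ∨ anyB (f ∘ suc)

eqB : ∀ {n} → Fin n → Fin n → Bool
eqB u v = ⌊ u ≟ v ⌋

degree : ∀ {n} → Graph n → Fin n → ℕ
degree G v = countB (adj G v)

-- The new graph has vertex set Fin n,
-- where vertex v stands for the old vertex  punchIn y v  (so y is
-- removed), and the old vertex x is replaced by the merged vertex {x,y},
-- which is  punchOut (y ≢ x).

private
  eqB-sym : ∀ {n} (u v : Fin n) → eqB u v ≡ eqB v u
  eqB-sym u v with u ≟ v | v ≟ u
  ... | yes _ | yes _ = refl
  ... | no _  | no _  = refl
  ... | yes p | no q  = Data.Empty.⊥-elim (q (sym p))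
    where import Data.Empty
  ... | no p  | yes q = Data.Empty.⊥-elim (p (sym q))
    where import Data.Empty

  eqB-refl : ∀ {n} (u : Fin n) → eqB u u ≡ true
  eqB-refl u with u ≟ u
  ... | yes _ = refl
  ... | no p  = Data.Empty.⊥-elim (p refl)
    where import Data.Empty

-- adjacency between (old) vertices a, b after identifying x and y
-- (meaningful for a, b ≠ y)
mergedAdj : ∀ {n} → Graph n → Fin n → Fin n → Fin n → Fin n → Bool
mergedAdj G x y a b =
  adj G a b ∨ ((eqB a x ∧ adj G y b) ∨ (eqB b x ∧ adj G a y))

private
  mergedAdj-sym : ∀ {n} (G : Graph n) x y a b →
                  mergedAdj G x y a b ≡ mergedAdj G x y b a
  mergedAdj-sym G x y a b
    rewrite adjSym G a b | adjSym G y b | adjSym G a y =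
    cong (adj G b a ∨_) (∨-comm (eqB a x ∧ adj G b y) (eqB b x ∧ adj G y a))

contract : ∀ {n} (G : Graph (suc n)) (x y : Fin (suc n)) → x ≢ y → Graph n
contract G x y _ = record
  { adj    = A
  ; adjSym = λ u v → cong₂ _∧_ (cong not (eqB-sym u v))
                       (mergedAdj-sym G x y (punchIn y u) (punchIn y v))
  ; irrefl = λ u → cong (λ b → not b ∧ mergedAdj G x y (punchIn y u) (punchIn y u))
                       (eqB-refl u)
  }
  where
  A : _ → _ → Bool
  A u v = not (eqB u v) ∧ mergedAdj G x y (punchIn y u) (punchIn y v)

mergedVertex : ∀ {n} (x y : Fin (suc n)) → x ≢ y → Fin n
mergedVertex x y x≢y = punchOut {i = y} {j = x} (λ e → x≢y (sym e))

Contractible : ℕ → Class → Set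
Contractible d C =
  ∀ n (G : Graph (suc (suc n))) → C (suc (suc n)) G →
  Σ (Fin (suc (suc n))) λ x → Σ (Fin (suc (suc n))) λ y → Σ (x ≢ y) λ x≢y →
    C (suc n) (contract G x y x≢y) × degree (contract G x y x≢y) (mergedVertex x y x≢y) ≤ d

-- Partitions of V(G) = Fin n into exactly i parts are encoded as
-- surjective labellings  f : Fin n → Fin i  (part of v is f v).

Surj : ∀ {n i} → (Fin n → Fin i) → Set
Surj {i = i} f = ∀ (X : Fin i) → ∃ λ v → f v ≡ X

Inj : ∀ {n i} → (Fin n → Fin i) → Set
Inj f = ∀ {u v} → f u ≡ f v → u ≡ v

redArc : ∀ {n i} → Graph n → (Fin n → Fin i) → Fin i → Fin i → Bool
redArc G f X Y =
  not (eqB X Y) ∧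
  anyB (λ v → eqB (f v) Y ∧
               (anyB (λ a → eqB (f a) X ∧ adj G v a) ∧
                anyB (λ b → eqB (f b) X ∧ not (adj G v b))))

redOutDegree : ∀ {n i} → Graph n → (Fin n → Fin i) → Fin i → ℕ
redOutDegree G f X = countB (redArc G f X)

RedOutDegAtMost : ∀ {n i} → ℕ → Graph n → (Fin n → Fin i) → Set
RedOutDegAtMost d G f = ∀ X → redOutDegree G f X ≤ d

-- Merging two parts of a partition into i+2 parts is encoded as
-- post-composing with a map g : Fin (i+2) → Fin (i+1) such that the
-- result is again a partition (surjective) into i+1 parts.
data GoodSeq {n : ℕ} (d : ℕ) (G : Graph n) : (i : ℕ) → (Fin n → Fin i) → Set where
  last : (f : Fin n → Fin 1) → Surj f → RedOutDegAtMost d G f → GoodSeq d G 1 f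
  step : ∀ {i} (f : Fin n → Fin (suc (suc i))) → Surj f → RedOutDegAtMost d G f →
         (g : Fin (suc (suc i)) → Fin (suc i)) →
         GoodSeq d G (suc i) (g ∘ f) → GoodSeq d G (suc (suc i)) f

-- The graph with no vertex has oriented twin-width 0 by convention.
OrientedTwinWidthAtMost : ∀ {n} → ℕ → Graph n → Set
OrientedTwinWidthAtMost {zero}  d G = ⊤
OrientedTwinWidthAtMost {suc n} d G =
  Σ (Fin (suc n) → Fin (suc n)) λ f → Inj f × GoodSeq d G (suc n) f

{-# OPTIONS --safe #-}
-- Follow the contraction sequence G = H(n), H(n-1), …, H(1) provided by
-- d-contractibility, and let the i-th partition consist of the preimages of
-- the vertices of H(i) under the accumulated contraction map.  Two facts are
-- maintained: an edge of G between two different parts is an edge of H(i)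
-- between those parts, and every part is a single vertex or has degree ≤ d
-- in H(i) (the merged vertex has degree ≤ d when it is created, and
-- contracting never raises the degree of any other vertex).  A red arc
-- X → Y needs an edge of G between Y and X, hence an edge XY of H(i), and it
-- needs two distinct vertices in X.  So every red out-degree is at most d.
module Submission where

open import Defs
open import Data.Nat using (ℕ; zero; suc; _+_; _≤_; z≤n; s≤s)
open import Data.Nat.Properties
  using (≤-refl; ≤-trans; ≤-reflexive; +-comm; +-assoc; +-suc; +-monoʳ-≤; m≤n⇒m≤1+n; module ≤-Reasoning)
open import Data.Bool using (Bool; true; false; not; _∧_; _∨_; T; if_then_else_)
open import Data.Bool.Properties using (T-∧; T-∨; T-not-≡)
open import Data.Fin using (Fin; zero; suc; punchIn; punchOut; _≟_)
open import Data.Fin.Properties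
  using (0≢1+n; suc-injective; punchInᵢ≢i; punchIn-injective; punchOut-cong; punchIn-punchOut; punchOut-punchIn)
open import Data.Product using (∃; _×_; _,_; proj₁; proj₂)
open import Data.Sum using (_⊎_; inj₁; inj₂)
open import Data.Unit using (tt)
open import Data.Empty using (⊥-elim)
open import Function using (_∘_; id)
open import Function.Bundles using (module Equivalence)
open import Relation.Nullary using (¬_; yes; no)
open import Relation.Nullary.Decidable using (toWitness; fromWitness; toWitnessFalse; fromWitnessFalse)
open import Relation.Binary.PropositionalEquality
  using (_≡_; _≢_; refl; sym; trans; cong; subst; subst₂; module ≡-Reasoning)

open Equivalence using (to; from)

⟦_⟧ : Bool → ℕ
⟦ b ⟧ = if b then 1 else 0

countB-mono : ∀ {m} {f g : Fin m → Bool} → (∀ v → T (f v) → T (g v)) → countB f ≤ countB g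
countB-mono {zero}          f⇒g = z≤n
countB-mono {suc m} {f} {g} f⇒g with f zero | g zero | f⇒g zero
... | true  | true  | _ = s≤s (countB-mono (f⇒g ∘ suc))
... | true  | false | k = ⊥-elim (k tt)
... | false | true  | _ = m≤n⇒m≤1+n (countB-mono (f⇒g ∘ suc))
... | false | false | _ = countB-mono (f⇒g ∘ suc)

countB-none : ∀ {m} {f : Fin m → Bool} → (∀ v → ¬ T (f v)) → countB f ≡ 0
countB-none {zero}      none = refl
countB-none {suc m} {f} none with f zero | none zero
... | true  | k = ⊥-elim (k tt)
... | false | _ = countB-none (none ∘ suc)

countB-≤1 : ∀ {m} {f : Fin m → Bool} → (∀ u v → T (f u) → T (f v) → u ≡ v) → countB f ≤ 1
countB-≤1 {zero}      unique = z≤n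
countB-≤1 {suc m} {f} unique with f zero | unique zero
... | true  | unique₀ = ≤-reflexive (cong suc (countB-none λ v fv → 0≢1+n (unique₀ (suc v) tt fv)))
... | false | _       = countB-≤1 λ u v fu fv → suc-injective (unique (suc u) (suc v) fu fv)

countB-∨ : ∀ {m} (f g : Fin m → Bool) → countB (λ v → f v ∨ g v) ≤ countB f + countB g
countB-∨ {zero}  f g = z≤n
countB-∨ {suc m} f g with f zero | g zero
... | true  | true  = s≤s (≤-trans (countB-∨ (f ∘ suc) (g ∘ suc))
                                   (+-monoʳ-≤ (countB (f ∘ suc)) (m≤n⇒m≤1+n ≤-refl)))
... | true  | false = s≤s (countB-∨ (f ∘ suc) (g ∘ suc))
... | false | true  = ≤-trans (s≤s (countB-∨ (f ∘ suc) (g ∘ suc)))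
                              (≤-reflexive (sym (+-suc (countB (f ∘ suc)) (countB (g ∘ suc)))))
... | false | false = countB-∨ (f ∘ suc) (g ∘ suc)

countB-punchIn : ∀ {m} (f : Fin (suc m) → Bool) y → countB f ≡ ⟦ f y ⟧ + countB (f ∘ punchIn y)
countB-punchIn         f zero    = refl
countB-punchIn {suc m} f (suc y) = begin
  ⟦ f zero ⟧ + countB (f ∘ suc)
    ≡⟨ cong (⟦ f zero ⟧ +_) (countB-punchIn (f ∘ suc) y) ⟩
  ⟦ f zero ⟧ + (⟦ f (suc y) ⟧ + rest)
    ≡⟨ sym (+-assoc ⟦ f zero ⟧ _ _) ⟩
  (⟦ f zero ⟧ + ⟦ f (suc y) ⟧) + rest
    ≡⟨ cong (_+ rest) (+-comm ⟦ f zero ⟧ _) ⟩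
  (⟦ f (suc y) ⟧ + ⟦ f zero ⟧) + rest
    ≡⟨ +-assoc ⟦ f (suc y) ⟧ _ _ ⟩
  ⟦ f (suc y) ⟧ + (⟦ f zero ⟧ + rest) ∎
  where
  open ≡-Reasoning
  rest : ℕ
  rest = countB (f ∘ suc ∘ punchIn y)

countB-≟-∧ : ∀ {m} (c : Fin m) b → countB (λ w → eqB w c ∧ b) ≤ ⟦ b ⟧
countB-≟-∧ c false = ≤-reflexive (countB-none λ w t → proj₂ (to (T-∧ {eqB w c}) t))
countB-≟-∧ c true  = countB-≤1 {f = λ w → eqB w c ∧ true} λ u v tu tv →
  trans (toWitness (proj₁ (to (T-∧ {eqB u c}) tu))) (sym (toWitness (proj₁ (to (T-∧ {eqB v c}) tv))))

anyB-witness : ∀ {m} (f : Fin m → Bool) → T (anyB f) → ∃ λ v → T (f v)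
anyB-witness {suc m} f t with to (T-∨ {f zero}) t
... | inj₁ t₀ = zero , t₀
... | inj₂ tₛ with anyB-witness (f ∘ suc) tₛ
... | v , tᵥ = suc v , tᵥ

anyB-∧-witness : ∀ {m} (p q : Fin m → Bool) →
                 T (anyB λ v → p v ∧ q v) → ∃ λ v → T (p v) × T (q v)
anyB-∧-witness p q t with anyB-witness (λ v → p v ∧ q v) t
... | v , tᵥ = v , to (T-∧ {p v}) tᵥ

record RedArcWitness {n i} (G : Graph n) (f : Fin n → Fin i) (X Y : Fin i) : Set where
  field
    X≢Y   : X ≢ Y
    v a b : Fin n
    v∈Y   : f v ≡ Y
    a∈X   : f a ≡ X
    b∈X   : f b ≡ X
    v~a   : T (adj G v a)
    v≁b   : adj G v b ≡ false

redArc-witness : ∀ {n i} (G : Graph n) (f : Fin n → Fin i) {X Y} →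
                 T (redArc G f X Y) → RedArcWitness G f X Y
redArc-witness G f {X} {Y} t
  with to (T-∧ {not (eqB X Y)}) t
... | X≢Y , arc
  with anyB-∧-witness (λ v → eqB (f v) Y)
         (λ v → anyB (λ a → eqB (f a) X ∧ adj G v a) ∧ anyB (λ b → eqB (f b) X ∧ not (adj G v b))) arc
... | v , v∈Y , mixed
  with to (T-∧ {anyB (λ a → eqB (f a) X ∧ adj G v a)}) mixed
... | some-neighbour , some-non-neighbour
  with anyB-∧-witness (λ a → eqB (f a) X) (adj G v) some-neighbour
     | anyB-∧-witness (λ b → eqB (f b) X) (not ∘ adj G v) some-non-neighbour
... | a , a∈X , v~a | b , b∈X , v≁b = record
  { X≢Y = toWitnessFalse X≢Y ; v = v ; a = a ; b = b
  ; v∈Y = toWitness v∈Y ; a∈X = toWitness a∈X ; b∈X = toWitness b∈X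
  ; v~a = v~a ; v≁b = to T-not-≡ v≁b
  }

Singleton : ∀ {n i} → (Fin n → Fin i) → Fin i → Set
Singleton f X = ∀ {a b} → f a ≡ X → f b ≡ X → a ≡ b

PreservesCrossEdges : ∀ {n i} → Graph n → Graph i → (Fin n → Fin i) → Set
PreservesCrossEdges G H f = ∀ {a b} → T (adj G a b) → f a ≢ f b → T (adj H (f a) (f b))

module _ {n i} (G : Graph n) (f : Fin n → Fin i) where

  redOutDegree-singleton : ∀ {X} → Singleton f X → redOutDegree G f X ≡ 0
  redOutDegree-singleton {X} single = countB-none {f = redArc G f X} λ Y arc →
    let open RedArcWitness (redArc-witness G f arc)
    in subst T v≁b (subst (T ∘ adj G v) (single a∈X b∈X) v~a)

  redArc⇒adj : ∀ (H : Graph i) → PreservesCrossEdges G H f →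
               ∀ {X Y} → T (redArc G f X Y) → T (adj H X Y)
  redArc⇒adj H cross {X} {Y} arc = subst T (adjSym H Y X) Y~X
    where
    open RedArcWitness (redArc-witness G f arc)
    Y~X : T (adj H Y X)
    Y~X = subst₂ (λ P Q → T (adj H P Q)) v∈Y a∈X
            (cross v~a λ fv≡fa → X≢Y (trans (sym a∈X) (trans (sym fv≡fa) v∈Y)))

  redOutDegree≤degree : ∀ (H : Graph i) → PreservesCrossEdges G H f →
                        ∀ X → redOutDegree G f X ≤ degree H X
  redOutDegree≤degree H cross X = countB-mono {f = redArc G f X} λ Y → redArc⇒adj H cross

record Tracks (d : ℕ) {n i} (G : Graph n) (H : Graph i) (f : Fin n → Fin i) : Set where
  field
    surjective  : Surj f
    crossEdges  : PreservesCrossEdges G H f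
    smallParts  : ∀ X → Singleton f X ⊎ degree H X ≤ d

  redOutDegAtMost : RedOutDegAtMost d G f
  redOutDegAtMost X with smallParts X
  ... | inj₁ single = subst (_≤ d) (sym (redOutDegree-singleton G f single)) z≤n
  ... | inj₂ small  = ≤-trans (redOutDegree≤degree G f H crossEdges X) small

tracks-id : ∀ d {n} (G : Graph n) → Tracks d G G id
tracks-id d G = record
  { surjective = λ X → X , refl
  ; crossEdges = λ a~b _ → a~b
  ; smallParts = λ X → inj₁ λ a∈X b∈X → trans a∈X (sym b∈X)
  }

module _ {m} (G : Graph m) {x y : Fin m} where

  mergedAdj-intro : ∀ {a b} → T (adj G a b) → T (mergedAdj G x y a b)
  mergedAdj-intro {a} {b} a~b = from (T-∨ {adj G a b}) (inj₁ a~b)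

  mergedAdj-introˡ : ∀ {b} → T (adj G y b) → T (mergedAdj G x y x b)
  mergedAdj-introˡ {b} y~b =
    from (T-∨ {adj G x b}) (inj₂ (from (T-∨ {eqB x x ∧ adj G y b})
      (inj₁ (from (T-∧ {eqB x x}) (fromWitness refl , y~b)))))

  mergedAdj-introʳ : ∀ {a} → T (adj G a y) → T (mergedAdj G x y a x)
  mergedAdj-introʳ {a} a~y =
    from (T-∨ {adj G a x}) (inj₂ (from (T-∨ {eqB a x ∧ adj G y x})
      (inj₂ (from (T-∧ {eqB x x}) (fromWitness refl , a~y)))))

  mergedAdj-elim : ∀ {a b} → T (mergedAdj G x y a b) →
                   T (adj G a b) ⊎ (a ≡ x × T (adj G y b)) ⊎ (b ≡ x × T (adj G a y))
  mergedAdj-elim {a} {b} t with to (T-∨ {adj G a b}) t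
  ... | inj₁ a~b = inj₁ a~b
  ... | inj₂ t′ with to (T-∨ {eqB a x ∧ adj G y b}) t′
  ... | inj₁ t″ = let a≡x , y~b = to (T-∧ {eqB a x}) t″ in inj₂ (inj₁ (toWitness a≡x , y~b))
  ... | inj₂ t″ = let b≡x , a~y = to (T-∧ {eqB b x}) t″ in inj₂ (inj₂ (toWitness b≡x , a~y))

module Contraction {k} (H : Graph (suc (suc k))) {x y : Fin (suc (suc k))} (x≢y : x ≢ y) where

  H/xy : Graph (suc k)
  H/xy = contract H x y x≢y

  xy : Fin (suc k)
  xy = mergedVertex x y x≢y

  quotient : Fin (suc (suc k)) → Fin (suc k)
  quotient w with y ≟ w
  ... | yes _   = xy
  ... | no y≢w = punchOut y≢w

  punchIn-xy : punchIn y xy ≡ x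
  punchIn-xy = punchIn-punchOut _

  punchIn≡x⇒xy : ∀ {W} → punchIn y W ≡ x → W ≡ xy
  punchIn≡x⇒xy {W} e = punchIn-injective y W xy (trans e (sym punchIn-xy))

  quotient-punchIn : ∀ Z → quotient (punchIn y Z) ≡ Z
  quotient-punchIn Z with y ≟ punchIn y Z
  ... | yes y≡↑Z = ⊥-elim (punchInᵢ≢i y Z (sym y≡↑Z))
  ... | no _     = trans (punchOut-cong y refl) (punchOut-punchIn y)

  quotient-fibre : ∀ {w Z} → quotient w ≡ Z → Z ≢ xy → w ≡ punchIn y Z
  quotient-fibre {w} e Z≢xy with y ≟ w
  ... | yes _   = ⊥-elim (Z≢xy (sym e))
  ... | no y≢w = trans (sym (punchIn-punchOut y≢w)) (cong (punchIn y) e)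

  mergedAdj-quotient : ∀ {u w} → T (adj H u w) →
                       T (mergedAdj H x y (punchIn y (quotient u)) (punchIn y (quotient w)))
  mergedAdj-quotient {u} {w} u~w with y ≟ u | y ≟ w
  ... | yes refl | yes refl = ⊥-elim (subst T (irrefl H y) u~w)
  ... | yes refl | no y≢w rewrite punchIn-xy | punchIn-punchOut y≢w = mergedAdj-introˡ H u~w
  ... | no y≢u | yes refl rewrite punchIn-xy | punchIn-punchOut y≢u = mergedAdj-introʳ H u~w
  ... | no y≢u | no y≢w rewrite punchIn-punchOut y≢u | punchIn-punchOut y≢w = mergedAdj-intro H u~w

  quotient-preservesEdges : ∀ {u w} → T (adj H u w) → quotient u ≢ quotient w →
                            T (adj H/xy (quotient u) (quotient w))
  quotient-preservesEdges u~w ne = from (T-∧ {not (eqB _ _)}) (fromWitnessFalse ne , mergedAdj-quotient u~w)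

  neighbours-contract : ∀ {Z W} → Z ≢ xy → T (adj H/xy Z W) →
                        T (adj H (punchIn y Z) (punchIn y W) ∨ (eqB W xy ∧ adj H (punchIn y Z) y))
  neighbours-contract {Z} {W} Z≢xy Z~W
    with mergedAdj-elim H {x} {y} (proj₂ (to (T-∧ {not (eqB Z W)}) Z~W))
  ... | inj₁ u~w                = from (T-∨ {adj H (punchIn y Z) (punchIn y W)}) (inj₁ u~w)
  ... | inj₂ (inj₁ (u≡x , _))   = ⊥-elim (Z≢xy (punchIn≡x⇒xy u≡x))
  ... | inj₂ (inj₂ (w≡x , u~y)) = from (T-∨ {adj H (punchIn y Z) (punchIn y W)})
    (inj₂ (from (T-∧ {eqB W xy}) (fromWitness (punchIn≡x⇒xy w≡x) , u~y)))

  degree-contract : ∀ {Z} → Z ≢ xy → degree H/xy Z ≤ degree H (punchIn y Z)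
  degree-contract {Z} Z≢xy = begin
    degree H/xy Z
      ≤⟨ countB-mono {f = adj H/xy Z} (λ W → neighbours-contract Z≢xy) ⟩
    countB (λ W → adj H u (punchIn y W) ∨ (eqB W xy ∧ adj H u y))
      ≤⟨ countB-∨ (adj H u ∘ punchIn y) (λ W → eqB W xy ∧ adj H u y) ⟩
    countB (adj H u ∘ punchIn y) + countB (λ W → eqB W xy ∧ adj H u y)
      ≤⟨ +-monoʳ-≤ (countB (adj H u ∘ punchIn y)) (countB-≟-∧ xy (adj H u y)) ⟩
    countB (adj H u ∘ punchIn y) + ⟦ adj H u y ⟧
      ≡⟨ +-comm (countB (adj H u ∘ punchIn y)) _ ⟩
    ⟦ adj H u y ⟧ + countB (adj H u ∘ punchIn y)
      ≡⟨ countB-punchIn (adj H u) y ⟨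
    degree H u ∎
    where
    open ≤-Reasoning
    u : Fin (suc (suc k))
    u = punchIn y Z

  tracks-quotient : ∀ {d n} {G : Graph n} {f : Fin n → Fin (suc (suc k))} →
                    Tracks d G H f → degree H/xy xy ≤ d → Tracks d G H/xy (quotient ∘ f)
  tracks-quotient {d} {f = f} t deg-xy = record
    { surjective = surjective
    ; crossEdges = λ a~b ne → quotient-preservesEdges (T.crossEdges a~b (ne ∘ cong quotient)) ne
    ; smallParts = smallParts
    }
    where
    module T = Tracks t
    surjective : Surj (quotient ∘ f)
    surjective Z with T.surjective (punchIn y Z)
    ... | v , fv≡↑Z = v , trans (cong quotient fv≡↑Z) (quotient-punchIn Z)
    smallParts : ∀ Z → Singleton (quotient ∘ f) Z ⊎ degree H/xy Z ≤ d
    smallParts Z with Z ≟ xy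
    ... | yes refl = inj₂ deg-xy
    ... | no Z≢xy with T.smallParts (punchIn y Z)
    ...   | inj₁ single = inj₁ λ ea eb → single (quotient-fibre ea Z≢xy) (quotient-fibre eb Z≢xy)
    ...   | inj₂ small  = inj₂ (≤-trans (degree-contract Z≢xy) small)

tracks⇒GoodSeq : ∀ d (C : Class) → Contractible d C → ∀ {n} {G : Graph n} m {H : Graph (suc m)} {f} →
                 C (suc m) H → Tracks d G H f → GoodSeq d G (suc m) f
tracks⇒GoodSeq d C contractible zero _ t = last _ (Tracks.surjective t) (Tracks.redOutDegAtMost t)
tracks⇒GoodSeq d C contractible (suc k) {H} {f} H∈C t with contractible k H H∈C
... | x , y , x≢y , H/xy∈C , deg-xy =
  step f (Tracks.surjective t) (Tracks.redOutDegAtMost t) quotient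
    (tracks⇒GoodSeq d C contractible k H/xy∈C (tracks-quotient t deg-xy))
  where open Contraction H x≢y

lemma4p2 : (d : ℕ) (C : Class) → Contractible d C →
           ∀ n (G : Graph n) → C n G → OrientedTwinWidthAtMost d G
lemma4p2 d C contractible zero    G _   = tt
lemma4p2 d C contractible (suc n) G G∈C =
  id , id , tracks⇒GoodSeq d C contractible n G∈C (tracks-id d G)
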